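{- Consider online preemptive scheduling of weighted intervals of equal length, normalized to length $1$: each interval $J$ has an arrival time $r(J)\ge 0$, length $1$, deadline $d(J)=r(J)+1$ and weight $w(J)\ge 0$. Let $RAN$ be the following randomized online algorithm. Divide time into unit slots $s_i=[i-1,i)$, $i=1,2,\dots$. Deterministic algorithm $A$ handles odd slots: within each odd slot $s_i$, $A$ starts the first interval arriving in $s_i$; whenever a new interval arrives in $s_i$ while $A$ is processing an interval, $A$ aborts the current interval and starts the new one if the new one has strictly larger weight, and otherwise discards the new one. At the end of $s_i$, $A$ runs the interval it is currently processing (if any) to completion without interruption (this happens during $s_{i+1}$), and then stays idle until the beginning of the next odd slot; $A$ ignores intervals arriving in even slots. Deterministic algorithm $B$ does the same on even slots. $RAN$ chooses $A$ or $B$ with probability $1/2$ each at the beginning and follows it thereafter. Then $RAN$ is $2$-competitive: for every input instance, the expected total weight of intervals completed by $RAN$ is at least $1/2$ of the total weight of intervals completed by an optimal offline schedule.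
   Context: Online interval scheduling with preemption: intervals are revealed at their arrival times; at any moment at most one interval is processed; an interval is completed only if it is started at its arrival time and processed without interruption until its deadline; the algorithm may abort the interval currently being processed (it is then lost) in order to start a newly arrived one. The value of a schedule is the total weight of completed intervals. The optimal offline schedule knows all intervals in advance and maximizes the value subject to completed intervals being pairwise disjoint (in the sense that one ends no later than the next starts).
   Formalization: The arrival times $r(J)$ and weights $w(J)$ are nonnegative rationals rather than nonnegative real numbers. -}

module Defs where

open import Data.Bool using (Bool; true; false; if_then_else_; not)
open import Data.Nat as ℕ using (ℕ; suc; _%_; _≡ᵇ_)
open import Data.Integer using (∣_∣)
open import Data.Rational using (ℚ; 0ℚ; 1ℚ; _+_; _≤_; _≤ᵇ_; floor)
open import Data.List using (List; []; _∷_; foldl; map; foldr)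
open import Data.Maybe using (Maybe; just; nothing)
open import Data.Product using (_×_; _,_)
open import Data.Sum using (_⊎_)
open import Data.List.Relation.Unary.All using (All)
open import Data.List.Relation.Unary.AllPairs using (AllPairs)
open import Data.List.Relation.Binary.Sublist.Propositional using (_⊆_)

record Job : Set where
  constructor job
  field
    arr : ℚ
    wt  : ℚ
open Job public

deadline : Job → ℚ
deadline j = arr j + 1ℚ

-- Slot index i such that r ∈ s_i = [i-1, i)  (for r ≥ 0): i = ⌊r⌋ + 1.
slot : Job → ℕ
slot j = suc ∣ floor (arr j) ∣

-- Algorithm with parity p handles slots s_i with i % 2 = p
-- (p = 1 : algorithm A, odd slots; p = 0 : algorithm B, even slots).
handles : ℕ → Job → Bool
handles p j = (slot j % 2) ≡ᵇ p

-- State: interval currently processed (if any), intervals completed so far.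
State : Set
State = Maybe Job × List Job

advance : Job → State → State
advance j (nothing , done) = (nothing , done)
advance j (just c , done) =
  if deadline c ≤ᵇ arr j then (nothing , c ∷ done) else (just c , done)

react : ℕ → Job → State → State
react p j (nothing , done) =
  if handles p j then (just j , done) else (nothing , done)
react p j (just c , done) =
  if handles p j
  then (if slot c ≡ᵇ slot j
        then (if not (wt j ≤ᵇ wt c) then (just j , done)
                                    else (just c , done))
        else (just c , done))   -- unreachable for valid instances
  else (just c , done)

step : ℕ → State → Job → State
step p s j = react p j (advance j s)

finish : State → List Job
finish (nothing , done) = done
finish (just c , done) = c ∷ done

-- Intervals completed by the deterministic algorithm of parity p, when the
-- intervals are revealed in list order.
completed : ℕ → List Job → List Job
completed p js = finish (foldl (step p) (nothing , []) js)

totalWeight : List Job → ℚ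
totalWeight js = foldr _+_ 0ℚ (map wt js)

valueA : List Job → ℚ
valueA js = totalWeight (completed 1 js)

valueB : List Job → ℚ
valueB js = totalWeight (completed 0 js)

Nonneg : Job → Set
Nonneg j = (0ℚ ≤ arr j) × (0ℚ ≤ wt j)

ArrivalOrdered : List Job → Set
ArrivalOrdered = AllPairs (λ a b → arr a ≤ arr b)

Disjoint : Job → Job → Set
Disjoint a b = (deadline a ≤ arr b) ⊎ (deadline b ≤ arr a)

Feasible : List Job → List Job → Set
Feasible js S = (S ⊆ js) × AllPairs Disjoint S

-- Disjoint intervals of an optimal schedule S lie in distinct slots, so S has at most
-- one interval per slot.  The algorithm of parity p completes, in each of its slots,
-- an interval at least as heavy as any other arriving there: an interval running past
-- the end of its slot only overlaps the next slot, which has the other parity.  Hence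
-- the intervals of S in odd slots weigh at most value(A), those in even slots at most
-- value(B), and averaging gives the factor 1/2.  The per-parity bound is proved by a
-- potential argument along the run of the algorithm.
module Submission where

open import Algebra.Bundles using (CommutativeMonoid)
open import Data.Bool using (Bool; true; false; if_then_else_; T)
open import Data.Bool.Properties using (T-≡)
open import Data.Empty using (⊥-elim)
open import Data.Integer as ℤ using (+_; ∣_∣)
import Data.Integer.Properties as ℤ
open import Data.List using (List; []; _∷_; foldl; filterᵇ)
open import Data.List.Relation.Binary.Sublist.Propositional using (_⊆_; []; _∷_; _∷ʳ_; ⊆-trans)
open import Data.List.Relation.Binary.Sublist.Propositional.Properties using (All-resp-⊆; filter-⊆)
open import Data.List.Relation.Unary.All using (All; _∷_)
open import Data.List.Relation.Unary.All.Properties using (all-filter)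
open import Data.List.Relation.Unary.AllPairs using (AllPairs; _∷_)
import Data.List.Relation.Unary.AllPairs.Properties as AllPairs
open import Data.Maybe using (just; nothing)
open import Data.Nat as ℕ using (ℕ; suc; zero; _%_; _≡ᵇ_)
import Data.Nat.Properties as ℕ
open import Data.Nat.Coprimality as Coprime using ()
open import Data.Nat.DivMod using (m*n/n≡m; m/n*n≤m; /-monoˡ-≤; [m+n]%n≡m%n; %-congˡ; m%n<n)
open import Data.Product using (_×_; _,_; proj₂)
open import Data.Rational using (ℚ; mkℚ; 0ℚ; 1ℚ; ½; _+_; _*_; _≤_; _<_; _≤ᵇ_; floor; *≤*)
import Data.Rational.Properties as ℚ
import Data.Rational.Unnormalised.Base as ℚᵘ
import Data.Rational.Unnormalised.Properties as ℚᵘ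
open import Data.Sum using (_⊎_; inj₁; inj₂)
open import Data.Unit using (⊤; tt)
open import Function using (_∘_)
open import Function.Bundles using (_⇔_; mk⇔; Equivalence)
open import Function.Properties.Equivalence using () renaming (trans to ⇔-trans)
open import Relation.Binary.PropositionalEquality
open import Relation.Nullary using (¬_)
open import Relation.Nullary.Decidable using (T?)

open import Defs

open CommutativeMonoid ℚ.+-0-commutativeMonoid using (commutativeSemigroup)
open import Algebra.Properties.CommutativeSemigroup commutativeSemigroup using (x∙yz≈y∙xz)

fromℕ : ℕ → ℚ
fromℕ k = mkℚ (+ k) 0 (Coprime.sym (Coprime.1-coprimeTo k))

fromℕ-suc : ∀ k → fromℕ (suc k) ≡ fromℕ k + 1ℚ
fromℕ-suc k =
  ℚ.toℚᵘ-injective (ℚᵘ.≃-sym (ℚᵘ.≃-trans (ℚ.toℚᵘ-homo-+ (fromℕ k) (fromℕ 1)) (ℚᵘ.*≡* cross)))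
  where
  cross : (+ k ℤ.* + 1 ℤ.+ + 1 ℤ.* + 1) ℤ.* + 1 ≡ + suc k ℤ.* + 1
  cross = trans (cong (λ z → (z ℤ.+ + 1) ℤ.* + 1) (ℤ.*-identityʳ (+ k)))
                (cong (λ n → + n ℤ.* + 1) (ℕ.+-comm k 1))

m*n≤o⇔m≤o/n : ∀ m o n .{{_ : ℕ.NonZero n}} → m ℕ.* n ℕ.≤ o ⇔ m ℕ.≤ o ℕ./ n
m*n≤o⇔m≤o/n m o n = mk⇔
  (λ mn≤o → subst (ℕ._≤ o ℕ./ n) (m*n/n≡m m n) (/-monoˡ-≤ n mn≤o))
  (λ m≤o/n → ℕ.≤-trans (ℕ.*-monoˡ-≤ n m≤o/n) (m/n*n≤m o n))

fromℕ-≤⇔≤-∣floor∣ : ∀ k {p} → 0ℚ ≤ p → fromℕ k ≤ p ⇔ k ℕ.≤ ∣ floor p ∣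
fromℕ-≤⇔≤-∣floor∣ k {p@(mkℚ (+ a) d _)} _ =
  subst (λ n → fromℕ k ≤ p ⇔ k ℕ.≤ n) (sym ∣floor∣≡) (⇔-trans fromℕ-≤⇔ (m*n≤o⇔m≤o/n k a (suc d)))
  where
  ∣floor∣≡ : ∣ floor p ∣ ≡ a ℕ./ suc d
  ∣floor∣≡ = trans (cong ∣_∣ (ℤ.+◃n≡+n _)) (ℕ.+-identityʳ _)
  cross : + k ℤ.* + suc d ℤ.≤ + a ℤ.* + 1 ⇔ k ℕ.* suc d ℕ.≤ a
  cross rewrite ℤ.*-identityʳ (+ a) | sym (ℤ.pos-* k (suc d)) = mk⇔ ℤ.drop‿+≤+ ℤ.+≤+
  fromℕ-≤⇔ : fromℕ k ≤ p ⇔ k ℕ.* suc d ℕ.≤ a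
  fromℕ-≤⇔ = ⇔-trans (mk⇔ ℚ.drop-*≤* *≤*) cross
fromℕ-≤⇔≤-∣floor∣ k {mkℚ ℤ.-[1+ _ ] _ _} (*≤* ())

module _ {p : ℚ} (0≤p : 0ℚ ≤ p) where

  fromℕ-∣floor∣-≤ : fromℕ ∣ floor p ∣ ≤ p
  fromℕ-∣floor∣-≤ = Equivalence.from (fromℕ-≤⇔≤-∣floor∣ _ 0≤p) ℕ.≤-refl

  <-fromℕ-suc-∣floor∣ : p < fromℕ (suc ∣ floor p ∣)
  <-fromℕ-suc-∣floor∣ = ℚ.≰⇒> (ℕ.n≮n _ ∘ Equivalence.to (fromℕ-≤⇔≤-∣floor∣ _ 0≤p))

  ∣floor∣-mono-≤ : ∀ {q} → p ≤ q → ∣ floor p ∣ ℕ.≤ ∣ floor q ∣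
  ∣floor∣-mono-≤ p≤q =
    Equivalence.to (fromℕ-≤⇔≤-∣floor∣ _ (ℚ.≤-trans 0≤p p≤q)) (ℚ.≤-trans fromℕ-∣floor∣-≤ p≤q)

slot-mono-≤ : ∀ {x y} → 0ℚ ≤ arr x → arr x ≤ arr y → slot x ℕ.≤ slot y
slot-mono-≤ 0≤x = ℕ.s≤s ∘ ∣floor∣-mono-≤ 0≤x

module _ {x y : Job} (0≤x : 0ℚ ≤ arr x) (0≤y : 0ℚ ≤ arr y) where
  open ℚ.≤-Reasoning

  slot-<-if-after-deadline : deadline x ≤ arr y → slot x ℕ.< slot y
  slot-<-if-after-deadline x+1≤y = ℕ.s≤s (Equivalence.to (fromℕ-≤⇔≤-∣floor∣ _ 0≤y) (begin
    fromℕ (suc ∣ floor (arr x) ∣)   ≡⟨ fromℕ-suc _ ⟩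
    fromℕ ∣ floor (arr x) ∣ + 1ℚ    ≤⟨ ℚ.+-monoˡ-≤ 1ℚ (fromℕ-∣floor∣-≤ 0≤x) ⟩
    arr x + 1ℚ                      ≤⟨ x+1≤y ⟩
    arr y                           ∎))

  slot-≤-suc-if-before-deadline : arr y < deadline x → slot y ℕ.≤ suc (slot x)
  slot-≤-suc-if-before-deadline y<x+1 = ℕ.s≤s (ℕ.≮⇒≥ λ 2+⌊x⌋≤⌊y⌋ → ℚ.<-irrefl refl (begin-strict
    arr y                                 <⟨ y<x+1 ⟩
    arr x + 1ℚ                            <⟨ ℚ.+-monoˡ-< 1ℚ (<-fromℕ-suc-∣floor∣ 0≤x) ⟩
    fromℕ (suc ∣ floor (arr x) ∣) + 1ℚ    ≡⟨ fromℕ-suc _ ⟨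
    fromℕ (suc (suc ∣ floor (arr x) ∣))   ≤⟨ Equivalence.from (fromℕ-≤⇔≤-∣floor∣ _ 0≤y) 2+⌊x⌋≤⌊y⌋ ⟩
    arr y                                 ∎))

m%2≢[1+m]%2 : ∀ m → m % 2 ≢ suc m % 2
m%2≢[1+m]%2 zero    ()
m%2≢[1+m]%2 (suc m) [1+m]≡[2+m] = m%2≢[1+m]%2 m (begin
  m % 2                ≡⟨ [m+n]%n≡m%n m 2 ⟨
  (m ℕ.+ 2) % 2        ≡⟨ %-congˡ (ℕ.+-comm m 2) ⟩
  suc (suc m) % 2      ≡⟨ [1+m]≡[2+m] ⟨
  suc m % 2            ∎)
  where open ≡-Reasoning

m≤n≤1+m⇒m%2≡n%2⇒m≡n : ∀ {m n} → m ℕ.≤ n → n ℕ.≤ suc m → m % 2 ≡ n % 2 → m ≡ n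
m≤n≤1+m⇒m%2≡n%2⇒m≡n {m} m≤n n≤1+m m≡n[2] with ℕ.m≤n⇒m<n∨m≡n m≤n
... | inj₂ m≡n = m≡n
... | inj₁ m<n with ℕ.≤-antisym m<n n≤1+m
...   | refl = ⊥-elim (m%2≢[1+m]%2 m m≡n[2])

m%2≡0⊎m%2≡1 : ∀ m → m % 2 ≡ 0 ⊎ m % 2 ≡ 1
m%2≡0⊎m%2≡1 m with m % 2 | m%n<n m 2
... | 0           | _                       = inj₁ refl
... | 1           | _                       = inj₂ refl
... | suc (suc _) | ℕ.s≤s (ℕ.s≤s ())

-- The two slots differ by at most one and have equal parity.
slot-≡-if-overlapping : ∀ {p c j} → T (handles p c) → T (handles p j) → Nonneg c → Nonneg j →
                        arr c ≤ arr j → arr j < deadline c → slot c ≡ slot j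
slot-≡-if-overlapping {p} {c} {j} hc hj (0≤c , _) (0≤j , _) c≤j j<c+1 =
  m≤n≤1+m⇒m%2≡n%2⇒m≡n (slot-mono-≤ {c} {j} 0≤c c≤j)
                       (slot-≤-suc-if-before-deadline {c} {j} 0≤c 0≤j j<c+1)
    (trans (ℕ.≡ᵇ⇒≡ (slot c % 2) p hc) (sym (ℕ.≡ᵇ⇒≡ (slot j % 2) p hj)))

slot-<-if-disjoint : ∀ {x y} → Nonneg x → Nonneg y → arr x ≤ arr y → Disjoint x y →
                     slot x ℕ.< slot y
slot-<-if-disjoint {x} {y} (0≤x , _) (0≤y , _) _   (inj₁ x+1≤y) =
  slot-<-if-after-deadline {x} {y} 0≤x 0≤y x+1≤y
slot-<-if-disjoint {x} {y} _         (0≤y , _) x≤y (inj₂ y+1≤x) =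
  ⊥-elim (ℕ.n≮n _ (slot-<-if-after-deadline {y} {y} 0≤y 0≤y (ℚ.≤-trans y+1≤x x≤y)))

-- With S the part of the optimal schedule still to come, the running interval c is
-- reserved when the next interval of S lies in c's slot; its weight then pays for that
-- interval instead of being credited to the algorithm.
reserved : Job → List Job → Bool
reserved c []      = false
reserved c (y ∷ _) = slot c ≡ᵇ slot y

reserved-cong : ∀ {c j} S → slot c ≡ slot j → reserved c S ≡ reserved j S
reserved-cong []      _    = refl
reserved-cong (y ∷ _) same = cong (_≡ᵇ slot y) same

unreserved-if-disjoint : ∀ {j S} → Nonneg j → All Nonneg S → All (λ y → arr j ≤ arr y) S →
                         All (Disjoint j) S → ¬ T (reserved j S)
unreserved-if-disjoint {S = []}    _  _        _         _          = λ ()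
unreserved-if-disjoint {S = _ ∷ _} nj (ny ∷ _) (j≤y ∷ _) (disj ∷ _) =
  ℕ.<⇒≢ (slot-<-if-disjoint nj ny j≤y disj) ∘ ℕ.≡ᵇ⇒≡ _ _

credit : Job → List Job → ℚ
credit c S = if reserved c S then 0ℚ else wt c

potential : State → List Job → ℚ
potential (nothing , done) S = totalWeight done
potential (just c , done)  S = credit c S + totalWeight done

credit-nonneg : ∀ {c} S → 0ℚ ≤ wt c → 0ℚ ≤ credit c S
credit-nonneg {c} S 0≤c with reserved c S
... | true  = ℚ.≤-refl
... | false = 0≤c

credit-≤-wt : ∀ {c} S → 0ℚ ≤ wt c → credit c S ≤ wt c
credit-≤-wt {c} S 0≤c with reserved c S
... | true  = 0≤c
... | false = ℚ.≤-refl

credit-mono : ∀ {c j} S → slot c ≡ slot j → wt c ≤ wt j → credit c S ≤ credit j S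
credit-mono {c} {j} S same c≤j with reserved c S | reserved j S | reserved-cong {c} {j} S same
... | true  | true  | _  = ℚ.≤-refl
... | false | false | _  = c≤j
... | true  | false | ()
... | false | true  | ()

credit-unreserved : ∀ {j} S → ¬ T (reserved j S) → credit j S ≡ wt j
credit-unreserved {j} S unres with reserved j S
... | true  = ⊥-elim (unres tt)
... | false = refl

Running : ℕ → State → List Job → Set
Running p (nothing , _) rest = ⊤
Running p (just c , _)  rest = T (handles p c) × Nonneg c × All (λ y → arr c ≤ arr y) rest

ActiveAt : Job → State → Set
ActiveAt j (nothing , _) = ⊤
ActiveAt j (just c , _)  = arr j < deadline c

p≤q+p : ∀ {p q} → 0ℚ ≤ q → p ≤ q + p
p≤q+p {p} {q} 0≤q = subst (_≤ q + p) (ℚ.+-identityˡ p) (ℚ.+-monoˡ-≤ p 0≤q)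

0+p+q≡q+p : ∀ p q → (0ℚ + p) + q ≡ q + p
0+p+q≡q+p p q = trans (cong (_+ q) (ℚ.+-identityˡ p)) (ℚ.+-comm p q)

advance-preserves-Running : ∀ {p j rest} s → Running p s rest → Running p (advance j s) rest
advance-preserves-Running         (nothing , _) _ = tt
advance-preserves-Running {j = j} (just c , _)  r with deadline c ≤ᵇ arr j
... | true  = tt
... | false = r

advance-ActiveAt : ∀ j s → ActiveAt j (advance j s)
advance-ActiveAt j (nothing , _) = tt
advance-ActiveAt j (just c , _) with deadline c ≤ᵇ arr j | ℚ.≤⇒≤ᵇ {deadline c} {arr j}
... | true  | _       = tt
... | false | c+1≰j  = ℚ.≰⇒> c+1≰j

potential-≤-advance : ∀ {p j rest} s S → Running p s rest →
                      potential s S ≤ potential (advance j s) S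
potential-≤-advance         (nothing , _)    S _ = ℚ.≤-refl
potential-≤-advance {j = j} (just c , done) S (_ , (_ , 0≤c) , _) with deadline c ≤ᵇ arr j
... | true  = ℚ.+-monoˡ-≤ (totalWeight done) (credit-≤-wt S 0≤c)
... | false = ℚ.≤-refl

react-preserves-Running : ∀ {p j rest} s → Running p s (j ∷ rest) → Nonneg j →
                          All (λ y → arr j ≤ arr y) rest → Running p (react p j s) rest
react-preserves-Running {p} {j} (nothing , _) _ nj j≤rest with handles p j in hj
... | true  = Equivalence.from T-≡ hj , nj , j≤rest
... | false = tt
react-preserves-Running {p} {j} (just c , _) (hc , nc , _ ∷ c≤rest) nj j≤rest with handles p j in hj
... | false = hc , nc , c≤rest
... | true with slot c ≡ᵇ slot j
...   | false = hc , nc , c≤rest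
...   | true with wt j ≤ᵇ wt c
...     | true  = hc , nc , c≤rest
...     | false = Equivalence.from T-≡ hj , nj , j≤rest

potential-≤-react : ∀ {p j} s S → 0ℚ ≤ wt j → potential s S ≤ potential (react p j s) S
potential-≤-react {p} {j} (nothing , _) S 0≤j with handles p j
... | true  = p≤q+p (credit-nonneg S 0≤j)
... | false = ℚ.≤-refl
potential-≤-react {p} {j} (just c , done) S 0≤j with handles p j
... | false = ℚ.≤-refl
... | true with slot c ≡ᵇ slot j | ℕ.≡ᵇ⇒≡ (slot c) (slot j)
...   | false | _    = ℚ.≤-refl
...   | true  | same with wt j ≤ᵇ wt c | ℚ.≤⇒≤ᵇ {wt j} {wt c}
...     | true  | _   = ℚ.≤-refl
...     | false | j≰c = ℚ.+-monoˡ-≤ (totalWeight done) (credit-mono S (same tt) (ℚ.<⇒≤ (ℚ.≰⇒> j≰c)))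

-- An interval j of S that the algorithm handles either starts on an idle machine,
-- or meets the running interval c in c's slot, where c was reserved for j; either
-- way the potential grows by at least wt j.
potential-react-gain : ∀ {p j rest} s S → Running p s (j ∷ rest) → ActiveAt j s → Nonneg j →
                       T (handles p j) → ¬ T (reserved j S) →
                       potential s (j ∷ S) + wt j ≤ potential (react p j s) S
potential-react-gain {p} {j} (nothing , done) S _ _ _ hj unres rewrite Equivalence.to T-≡ hj =
  ℚ.≤-reflexive (trans (ℚ.+-comm (totalWeight done) (wt j))
                       (cong (_+ totalWeight done) (sym (credit-unreserved S unres))))
potential-react-gain {p} {j} (just c , done) S (hc , nc , c≤j ∷ _) j<c+1 nj hj unres
  with same ← slot-≡-if-overlapping hc hj nc nj c≤j j<c+1
  with slot c ≡ᵇ slot j | ℕ.≡⇒≡ᵇ (slot c) (slot j) same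
... | true | _ rewrite Equivalence.to T-≡ hj with wt j ≤ᵇ wt c | ℚ.≤ᵇ⇒≤ {wt j} {wt c}
...   | true  | j≤c = begin
  (0ℚ + t) + wt j  ≡⟨ 0+p+q≡q+p t (wt j) ⟩
  wt j + t         ≤⟨ ℚ.+-monoˡ-≤ t (j≤c tt) ⟩
  wt c + t         ≡⟨ cong (_+ t) (credit-unreserved S (unres ∘ subst T (reserved-cong S same))) ⟨
  credit c S + t   ∎
  where open ℚ.≤-Reasoning; t = totalWeight done
...   | false | _   =
  ℚ.≤-reflexive (trans (0+p+q≡q+p t (wt j)) (cong (_+ t) (sym (credit-unreserved S unres))))
  where t = totalWeight done

step-preserves-Running : ∀ {p j rest} s → Running p s (j ∷ rest) → Nonneg j →
                         All (λ y → arr j ≤ arr y) rest → Running p (step p s j) rest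
step-preserves-Running {j = j} s r =
  react-preserves-Running (advance j s) (advance-preserves-Running s r)

potential-≤-step : ∀ {p j rest} s S → Running p s rest → 0ℚ ≤ wt j →
                   potential s S ≤ potential (step p s j) S
potential-≤-step {j = j} s S r 0≤j =
  ℚ.≤-trans (potential-≤-advance s S r) (potential-≤-react (advance j s) S 0≤j)

potential-step-gain : ∀ {p j rest} s S → Running p s (j ∷ rest) → Nonneg j → T (handles p j) →
                      ¬ T (reserved j S) → potential s (j ∷ S) + wt j ≤ potential (step p s j) S
potential-step-gain {j = j} s S r nj hj unres =
  ℚ.≤-trans (ℚ.+-monoˡ-≤ (wt j) (potential-≤-advance s (j ∷ S) r))
            (potential-react-gain (advance j s) S (advance-preserves-Running s r)
                                  (advance-ActiveAt j s) nj hj unres)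

potential-+-weight-≤-completed : ∀ p rest s S → All Nonneg rest → ArrivalOrdered rest →
  Running p s rest → S ⊆ rest → AllPairs Disjoint S → All (T ∘ handles p) S →
  potential s S + totalWeight S ≤ totalWeight (finish (foldl (step p) s rest))
potential-+-weight-≤-completed p [] (nothing , _) [] _ _ _ [] _ _ = ℚ.≤-reflexive (ℚ.+-identityʳ _)
potential-+-weight-≤-completed p [] (just _ , _)  [] _ _ _ [] _ _ = ℚ.≤-reflexive (ℚ.+-identityʳ _)
potential-+-weight-≤-completed p (j ∷ rest) s S (nj ∷ nrest) (j≤rest ∷ ord) r
                               (.j ∷ʳ S⊆rest) disj hS =
  ℚ.≤-trans (ℚ.+-monoˡ-≤ (totalWeight S) (potential-≤-step s S r (proj₂ nj)))
            (potential-+-weight-≤-completed p rest (step p s j) S nrest ord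
              (step-preserves-Running s r nj j≤rest) S⊆rest disj hS)
potential-+-weight-≤-completed p (j ∷ rest) s (.j ∷ S) (nj ∷ nrest) (j≤rest ∷ ord) r
                               (refl ∷ S⊆rest) (j-disj ∷ disj) (hj ∷ hS) = begin
  potential s (j ∷ S) + (wt j + totalWeight S)
    ≡⟨ ℚ.+-assoc (potential s (j ∷ S)) (wt j) (totalWeight S) ⟨
  potential s (j ∷ S) + wt j + totalWeight S
    ≤⟨ ℚ.+-monoˡ-≤ (totalWeight S) (potential-step-gain s S r nj hj unres) ⟩
  potential (step p s j) S + totalWeight S
    ≤⟨ potential-+-weight-≤-completed p rest (step p s j) S nrest ord
         (step-preserves-Running s r nj j≤rest) S⊆rest disj hS ⟩
  totalWeight (finish (foldl (step p) (step p s j) rest)) ∎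
  where
  open ℚ.≤-Reasoning
  unres : ¬ T (reserved j S)
  unres = unreserved-if-disjoint nj (All-resp-⊆ S⊆rest nrest) (All-resp-⊆ S⊆rest j≤rest) j-disj

parityWeight : ℕ → List Job → ℚ
parityWeight p xs = totalWeight (filterᵇ (handles p) xs)

totalWeight-by-parity : ∀ xs → totalWeight xs ≡ parityWeight 1 xs + parityWeight 0 xs
totalWeight-by-parity []       = sym (ℚ.+-identityʳ 0ℚ)
totalWeight-by-parity (x ∷ xs) with m%2≡0⊎m%2≡1 (slot x) | totalWeight-by-parity xs
... | inj₁ even | ih rewrite even =
  trans (cong (λ w → wt x + w) ih) (x∙yz≈y∙xz (wt x) (parityWeight 1 xs) (parityWeight 0 xs))
... | inj₂ odd  | ih rewrite odd  =
  trans (cong (λ w → wt x + w) ih) (sym (ℚ.+-assoc (wt x) (parityWeight 1 xs) (parityWeight 0 xs)))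

parityWeight-≤-completed : ∀ p js S → All Nonneg js → ArrivalOrdered js → Feasible js S →
                           parityWeight p S ≤ totalWeight (completed p js)
parityWeight-≤-completed p js S nn ord (S⊆js , disj) =
  subst (_≤ totalWeight (completed p js)) (ℚ.+-identityˡ _)
    (potential-+-weight-≤-completed p js (nothing , []) (filterᵇ (handles p) S) nn ord tt
      (⊆-trans (filter-⊆ (T? ∘ handles p) S) S⊆js) (AllPairs.filter⁺ (T? ∘ handles p) disj)
      (all-filter (T? ∘ handles p) S))

mainTheorem1 : (js : List Job) → All Nonneg js → ArrivalOrdered js →
    (S : List Job) → Feasible js S →
    ½ * totalWeight S ≤ ½ * valueA js + ½ * valueB js
mainTheorem1 js nn ord S feas = begin
  ½ * totalWeight S
    ≡⟨ cong (½ *_) (totalWeight-by-parity S) ⟩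
  ½ * (parityWeight 1 S + parityWeight 0 S)
    ≤⟨ ℚ.*-monoˡ-≤-nonNeg ½ (ℚ.+-mono-≤ (parityWeight-≤-completed 1 js S nn ord feas)
                                        (parityWeight-≤-completed 0 js S nn ord feas)) ⟩
  ½ * (valueA js + valueB js)
    ≡⟨ ℚ.*-distribˡ-+ ½ (valueA js) (valueB js) ⟩
  ½ * valueA js + ½ * valueB js ∎
  where open ℚ.≤-Reasoning
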